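{- (Ditransitive verbs, Strategy C.) Let $X_1,X_2,X_3$ be sets. For $\delta',\delta\in\{l,r\}$ (and either choice $\delta''\in\{l,r\}$) define $\mathrm{strat}^{\delta',\delta}_C:\mathcal C(X_1)\times\mathcal P(X_1\times X_2\times X_3)\times\mathcal C(X_2)\times\mathcal C(X_3)\to\mathbf 2$ by $$\mathrm{strat}^{\delta',\delta}_C(Q_1,P,Q_2,Q_3)=\mathrm{ev}_{\mathrm{id}_{\mathbf 2}}\Big(\mathrm{cps}^{\delta'}(\epsilon^r_{X_1})\Big(Q_1,\ \mathrm{cps}^{\delta}(\epsilon^l_{X_3})\big(\mathrm{cps}^{\delta''}(\epsilon^l_{X_2})(\eta_{\mathcal P(X_1\times X_2\times X_3)}(P),Q_2),\ Q_3\big)\Big)\Big).$$ For a permutation $\sigma$ of $\{1,2,3\}$ let $$\mathrm{strat}^{3,\sigma}_B(Q_1,P,Q_2,Q_3)=\mathcal C(\rho_\sigma)\big(\mathrm{pu}^l(Q_{\sigma(1)},\mathrm{pu}^l(Q_{\sigma(2)},Q_{\sigma(3)}))\big)(P),$$ with $\rho_\sigma:X_{\sigma(1)}\times X_{\sigma(2)}\times X_{\sigma(3)}\to X_1\times X_2\times X_3$ the bijection placing the $i$-th component in position $\sigma(i)$ (and $X_{\sigma(1)}\times(X_{\sigma(2)}\times X_{\sigma(3)})$ identified with the triple product). Then, writing $\sigma$ as the list $(\sigma(1),\sigma(2),\sigma(3))$, $$\mathrm{strat}^{l,l}_C=\mathrm{strat}^{3,(1,2,3)}_B,\quad \mathrm{strat}^{l,r}_C=\mathrm{strat}^{3,(1,3,2)}_B,\quad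 \mathrm{strat}^{r,l}_C=\mathrm{strat}^{3,(2,3,1)}_B,\quad \mathrm{strat}^{r,r}_C=\mathrm{strat}^{3,(3,2,1)}_B.$$ Thus Strategy C yields exactly the four of the six scope readings of Strategies A and B in which the subject quantifier $Q_1$ takes either widest or narrowest scope (the orders $(2,1,3)$ and $(3,1,2)$ are not obtained).
   Context: Let $\mathbf 2=\{\mathrm{true},\mathrm{false}\}$ and, for a set $X$, $\mathcal P(X)$ the set of functions $X\to\mathbf 2$. Continuation monad: $\mathcal C(X)=\mathcal P(\mathcal P(X))$; for $f:X\to Y$, $\mathcal C(f)(Q)=\lambda h_{:\mathcal P(Y)}.\,Q(h\circ f)$; unit $\eta_X(x)=\lambda h.\,h(x)$; multiplication $\mu_X(\mathcal F)=\lambda h.\,\mathcal F(\lambda D_{:\mathcal C(X)}.\,D(h))$. Pile-ups $\mathrm{pu}^l,\mathrm{pu}^r:\mathcal C(X)\times\mathcal C(Y)\to\mathcal C(X\times Y)$: $\mathrm{pu}^l(M,N)=\lambda c.\,M(\lambda x.\,N(\lambda y.\,c(x,y)))$, $\mathrm{pu}^r(M,N)=\lambda c.\,N(\lambda y.\,M(\lambda x.\,c(x,y)))$. For $g:X\times Y\to Z$ and $\delta\in\{l,r\}$, $\mathrm{cps}^\delta(g)=\mu_Z\circ\mathcal C(\eta_Z\circ g)\circ\mathrm{pu}^\delta:\mathcal C(X)\times\mathcal C(Y)\to\mathcal C(Z)$. Maps used: $\epsilon^l_{X_2}:\mathcal P(X_1\times X_2\times X_3)\times X_2\to\mathcal P(X_1\times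 X_3)$, $(c,y)\mapsto\lambda(x,z).\,c(x,y,z)$; $\epsilon^l_{X_3}:\mathcal P(X_1\times X_3)\times X_3\to\mathcal P(X_1)$, $(c,z)\mapsto\lambda x.\,c(x,z)$; $\epsilon^r_{X_1}:X_1\times\mathcal P(X_1)\to\mathbf 2$, $(x,h)\mapsto h(x)$; $\mathrm{ev}_{\mathrm{id}_{\mathbf 2}}(R)=R(\mathrm{id}_{\mathbf 2})$ for $R\in\mathcal C(\mathbf 2)$. Here $Q_1$ interprets the subject, $Q_2,Q_3$ the two objects, and $P$ the ditransitive verb. -}

module Defs where

open import Data.Bool using (Bool)
open import Data.Product using (_×_; _,_)
open import Function using (_∘_; id)

𝒫 : Set → Set
𝒫 X = X → Bool

𝒞 : Set → Set
𝒞 X = 𝒫 (𝒫 X)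

𝒞map : {X Y : Set} → (X → Y) → 𝒞 X → 𝒞 Y
𝒞map f Q = λ h → Q (h ∘ f)

η : {X : Set} → X → 𝒞 X
η x = λ h → h x

μ : {X : Set} → 𝒞 (𝒞 X) → 𝒞 X
μ F = λ h → F (λ D → D h)

data Dir : Set where
  l r : Dir

pu : Dir → {X Y : Set} → 𝒞 X × 𝒞 Y → 𝒞 (X × Y)
pu l (M , N) = λ c → M (λ x → N (λ y → c (x , y)))
pu r (M , N) = λ c → N (λ y → M (λ x → c (x , y)))

cps : Dir → {X Y Z : Set} → (X × Y → Z) → 𝒞 X × 𝒞 Y → 𝒞 Z
cps δ g = μ ∘ 𝒞map (η ∘ g) ∘ pu δ

-- triple products are X₁ × (X₂ × X₃)
εˡ₂ : {X₁ X₂ X₃ : Set} → 𝒫 (X₁ × X₂ × X₃) × X₂ → 𝒫 (X₁ × X₃)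
εˡ₂ (c , y) = λ { (x , z) → c (x , y , z) }

εˡ₃ : {X₁ X₃ : Set} → 𝒫 (X₁ × X₃) × X₃ → 𝒫 X₁
εˡ₃ (c , z) = λ x → c (x , z)

εʳ₁ : {X₁ : Set} → X₁ × 𝒫 X₁ → Bool
εʳ₁ (x , h) = h x

ev-id : 𝒞 Bool → Bool
ev-id R = R id

stratC : (δ' δ δ'' : Dir) {X₁ X₂ X₃ : Set} →
         𝒞 X₁ → 𝒫 (X₁ × X₂ × X₃) → 𝒞 X₂ → 𝒞 X₃ → Bool
stratC δ' δ δ'' Q₁ P Q₂ Q₃ =
  ev-id (cps δ' εʳ₁ (Q₁ , cps δ εˡ₃ (cps δ'' εˡ₂ (η P , Q₂) , Q₃)))

data Idx : Set where
  i1 i2 i3 : Idx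

data Perm3 : Set where
  p123 p132 p213 p231 p312 p321 : Perm3

app : Perm3 → Idx → Idx
app p123 i1 = i1
app p123 i2 = i2
app p123 i3 = i3
app p132 i1 = i1
app p132 i2 = i3
app p132 i3 = i2
app p213 i1 = i2
app p213 i2 = i1
app p213 i3 = i3
app p231 i1 = i2
app p231 i2 = i3
app p231 i3 = i1
app p312 i1 = i3
app p312 i2 = i1
app p312 i3 = i2
app p321 i1 = i3
app p321 i2 = i2
app p321 i3 = i1

module _ {X₁ X₂ X₃ : Set} where

  Xi : Idx → Set
  Xi i1 = X₁
  Xi i2 = X₂
  Xi i3 = X₃

  Qi : 𝒞 X₁ → 𝒞 X₂ → 𝒞 X₃ → (i : Idx) → 𝒞 (Xi i)
  Qi Q₁ Q₂ Q₃ i1 = Q₁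
  Qi Q₁ Q₂ Q₃ i2 = Q₂
  Qi Q₁ Q₂ Q₃ i3 = Q₃

  ρ : (σ : Perm3) → Xi (app σ i1) × Xi (app σ i2) × Xi (app σ i3) → X₁ × X₂ × X₃
  ρ p123 (a , b , c) = (a , b , c)
  ρ p132 (a , b , c) = (a , c , b)
  ρ p213 (a , b , c) = (b , a , c)
  ρ p231 (a , b , c) = (c , a , b)
  ρ p312 (a , b , c) = (b , c , a)
  ρ p321 (a , b , c) = (c , b , a)

  stratB3 : Perm3 → 𝒞 X₁ → 𝒫 (X₁ × X₂ × X₃) → 𝒞 X₂ → 𝒞 X₃ → Bool
  stratB3 σ Q₁ P Q₂ Q₃ =
    𝒞map (ρ σ) (pu l (Q (app σ i1) , pu l (Q (app σ i2) , Q (app σ i3)))) P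
    where Q = Qi Q₁ Q₂ Q₃

-- The innermost pile-up combines the verb with the unit η P, and a unit commutes
-- with every continuation, so δ'' is irrelevant.  Once it is fixed, unfolding
-- cps, μ and the pile-ups shows each Strategy C term is literally the nested
-- pile-up of Strategy B in the corresponding quantifier order.
module Submission where

open import Data.Product using (_×_; _,_)
open import Function using (_∘′_)
open import Relation.Binary.PropositionalEquality using (_≡_; refl; sym; cong; trans)

open import Defs

pu-η : (δ : Dir) {X Y : Set} (x : X) (N : 𝒞 Y) → pu δ (η x , N) ≡ 𝒞map (x ,_) N
pu-η l x N = refl
pu-η r x N = refl

cps-η : (δ : Dir) {X Y Z : Set} (g : X × Y → Z) (x : X) (N : 𝒞 Y) →
        cps δ g (η x , N) ≡ cps l g (η x , N)
cps-η δ g x N = cong (λ M → μ (𝒞map (η ∘′ g) M)) (trans (pu-η δ x N) (sym (pu-η l x N)))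

stratC-δ''-irrelevant : (δ' δ δ'' : Dir) {X₁ X₂ X₃ : Set}
  (Q₁ : 𝒞 X₁) (P : 𝒫 (X₁ × X₂ × X₃)) (Q₂ : 𝒞 X₂) (Q₃ : 𝒞 X₃) →
  stratC δ' δ δ'' Q₁ P Q₂ Q₃ ≡ stratC δ' δ l Q₁ P Q₂ Q₃
stratC-δ''-irrelevant δ' δ δ'' Q₁ P Q₂ Q₃ =
  cong (λ V → ev-id (cps δ' εʳ₁ (Q₁ , cps δ εˡ₃ (V , Q₃)))) (cps-η δ'' εˡ₂ P Q₂)

module _ {X₁ X₂ X₃ : Set} (Q₁ : 𝒞 X₁) (P : 𝒫 (X₁ × X₂ × X₃)) (Q₂ : 𝒞 X₂) (Q₃ : 𝒞 X₃) where

  stratC-ll≡stratB3-123 : stratC l l l Q₁ P Q₂ Q₃ ≡ stratB3 p123 Q₁ P Q₂ Q₃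
  stratC-ll≡stratB3-123 = refl

  stratC-lr≡stratB3-132 : stratC l r l Q₁ P Q₂ Q₃ ≡ stratB3 p132 Q₁ P Q₂ Q₃
  stratC-lr≡stratB3-132 = refl

  stratC-rl≡stratB3-231 : stratC r l l Q₁ P Q₂ Q₃ ≡ stratB3 p231 Q₁ P Q₂ Q₃
  stratC-rl≡stratB3-231 = refl

  stratC-rr≡stratB3-321 : stratC r r l Q₁ P Q₂ Q₃ ≡ stratB3 p321 Q₁ P Q₂ Q₃
  stratC-rr≡stratB3-321 = refl

mainTheorem8 : {X₁ X₂ X₃ : Set} (δ'' : Dir) (Q₁ : 𝒞 X₁) (P : 𝒫 (X₁ × X₂ × X₃)) (Q₂ : 𝒞 X₂) (Q₃ : 𝒞 X₃) →
    (stratC l l δ'' Q₁ P Q₂ Q₃ ≡ stratB3 p123 Q₁ P Q₂ Q₃)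
    × (stratC l r δ'' Q₁ P Q₂ Q₃ ≡ stratB3 p132 Q₁ P Q₂ Q₃)
    × (stratC r l δ'' Q₁ P Q₂ Q₃ ≡ stratB3 p231 Q₁ P Q₂ Q₃)
    × (stratC r r δ'' Q₁ P Q₂ Q₃ ≡ stratB3 p321 Q₁ P Q₂ Q₃)
mainTheorem8 δ'' Q₁ P Q₂ Q₃ =
    trans (irrelevant l l) (stratC-ll≡stratB3-123 Q₁ P Q₂ Q₃)
  , trans (irrelevant l r) (stratC-lr≡stratB3-132 Q₁ P Q₂ Q₃)
  , trans (irrelevant r l) (stratC-rl≡stratB3-231 Q₁ P Q₂ Q₃)
  , trans (irrelevant r r) (stratC-rr≡stratB3-321 Q₁ P Q₂ Q₃)
  where
  irrelevant : (δ' δ : Dir) → stratC δ' δ δ'' Q₁ P Q₂ Q₃ ≡ stratC δ' δ l Q₁ P Q₂ Q₃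
  irrelevant δ' δ = stratC-δ''-irrelevant δ' δ δ'' Q₁ P Q₂ Q₃
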